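{- Let $\phi\in{\cal L}^C_{\cal G}$ and let $\sigma:{\cal A}\to{\cal A}'$ be a partial map into a set ${\cal A}'$ of agents such that $\sigma(G)\neq\emptyset$ for all $G\in{\cal G}_\phi$. Suppose there is a mapping $\tau:{\cal A}'\to 2^{\cal A}-\{\emptyset\}$ such that $\bigcup\{\tau(A):A\in\sigma(G)\}=G$ for all $G\in{\cal G}_\phi$. Then $\phi$ is satisfiable in ${\cal M}_{\cal A}$ (resp. ${\cal M}^r_{\cal A}$) iff $\phi^\sigma$ is satisfiable in ${\cal M}_{{\cal A}'}$ (resp. ${\cal M}^r_{{\cal A}'}$).
   Context: ${\cal A}$ is a (possibly infinite) set of agents, ${\cal G}$ a set of nonempty subsets of ${\cal A}$; ${\cal L}^C_{\cal G}$ is the smallest set of formulas containing a set $\Phi$ of primitive propositions and closed under $\wedge,\neg$, $K_i$ ($i\in{\cal A}$), $E_G,C_G$ ($G\in{\cal G}$). We identify $K_i$ with $E_{\{i\}}$. ${\cal G}_\phi$ is the set of all sets $G$ such that $E_G$ or $C_G$ occurs in $\phi$ (so $\{i\}\in{\cal G}_\phi$ if $K_i$ occurs). For a partial map $\sigma$, $\sigma(G)=\{\sigma(i):i\in G,\ \sigma(i)\text{ defined}\}$, and $\phi^\sigma$ is obtained from $\phi$ by replacing each occurrence of $E_G$, $C_G$ by $E_{\sigma(G)}$, $C_{\sigma(G)}$ (so $K_i$ becomes $K_{\sigma(i)}$); it is a formula over the agent set ${\cal A}'$. Kripke structures $M=(S,\pi,\{{\cal K}_i\})$: $(M,s)\models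 K_i\phi$ iff $\phi$ holds at all ${\cal K}_i$-successors of $s$; $(M,s)\models E_G\phi$ iff $(M,s)\models K_i\phi$ for all $i\in G$; $(M,s)\models C_G\phi$ iff $(M,s)\models E^k_G\phi$ for all $k\ge1$. ${\cal M}_{\cal A}$ is the class of all structures over ${\cal A}$, ${\cal M}^r_{\cal A}$ those with all ${\cal K}_i$ reflexive; similarly for ${\cal A}'$. -}

module Defs where

open import Data.Nat using (ℕ; zero; suc)
open import Data.Bool using (Bool; true)
open import Data.Maybe using (Maybe; just)
open import Data.Product using (Σ; _×_)
open import Data.Unit using (⊤)
open import Data.Empty using (⊥)
open import Function using (_∘_)
open import Function.Bundles using (_⇔_)
open import Relation.Binary.PropositionalEquality using (_≡_)

Group : Set → Set₁
Group A = A → Set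

Nonempty : {A : Set} → Group A → Set
Nonempty {A} G = Σ A G

-- Formulas of L^C over primitive propositions Φ and agents A.
-- K_i is identified with E_{i} (so there is no separate K constructor).
data Formula (Φ A : Set) : Set₁ where
  atom : Φ → Formula Φ A
  _∧′_ : Formula Φ A → Formula Φ A → Formula Φ A
  ¬′_  : Formula Φ A → Formula Φ A
  E    : Group A → Formula Φ A → Formula Φ A
  C    : Group A → Formula Φ A → Formula Φ A

⟦_⟧ : {A : Set} → A → Group A
⟦ i ⟧ j = i ≡ j

K : {Φ A : Set} → A → Formula Φ A → Formula Φ A
K i = E ⟦ i ⟧

-- "P G holds for every G ∈ 𝒢_φ" (every group G such that E_G or C_G occurs in φ)
AllGroups : {Φ A : Set} → (Group A → Set) → Formula Φ A → Set
AllGroups P (atom p) = ⊤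
AllGroups P (φ ∧′ ψ) = AllGroups P φ × AllGroups P ψ
AllGroups P (¬′ φ)   = AllGroups P φ
AllGroups P (E G φ)  = P G × AllGroups P φ
AllGroups P (C G φ)  = P G × AllGroups P φ

image : {A A' : Set} → (A → Maybe A') → Group A → Group A'
image {A} σ G a = Σ A (λ i → G i × σ i ≡ just a)

_^_ : {Φ A A' : Set} → Formula Φ A → (A → Maybe A') → Formula Φ A'
atom p   ^ σ = atom p
(φ ∧′ ψ) ^ σ = (φ ^ σ) ∧′ (ψ ^ σ)
(¬′ φ)   ^ σ = ¬′ (φ ^ σ)
E G φ    ^ σ = E (image σ G) (φ ^ σ)
C G φ    ^ σ = C (image σ G) (φ ^ σ)

record Kripke (Φ A : Set) : Set₁ where
  field
    S  : Set
    π  : S → Φ → Bool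
    𝒦  : A → S → S → Set

Reflexive : {Φ A : Set} → Kripke Φ A → Set
Reflexive M = ∀ i s → Kripke.𝒦 M i s s

iter : {X : Set₁} → ℕ → (X → X) → X → X
iter zero    f x = x
iter (suc n) f x = f (iter n f x)

module _ {Φ A : Set} (M : Kripke Φ A) where
  open Kripke M

  semK : A → (S → Set) → S → Set
  semK i P s = ∀ t → 𝒦 i s t → P t

  semE : Group A → (S → Set) → S → Set
  semE G P s = ∀ i → G i → semK i P s

  sat : S → Formula Φ A → Set
  sat s (atom p) = π s p ≡ true
  sat s (φ ∧′ ψ) = sat s φ × sat s ψ
  sat s (¬′ φ) = sat s φ → ⊥
  sat s (E G φ) = semE G (λ t → sat t φ) s
  sat s (C G φ) = ∀ k → iter (suc k) (semE G) (λ t → sat t φ) s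

Satisfiable : {Φ A : Set} → Formula Φ A → Set₁
Satisfiable {Φ} {A} φ = Σ (Kripke Φ A) (λ M → Σ (Kripke.S M) (λ s → sat M s φ))

SatisfiableR : {Φ A : Set} → Formula Φ A → Set₁
SatisfiableR {Φ} {A} φ =
  Σ (Kripke Φ A) (λ M → Reflexive M × Σ (Kripke.S M) (λ s → sat M s φ))

-- Both directions keep the states and valuation and only rename the accessibility relations.
-- From a structure over A, let agent a of A' know what the agents τ(a) jointly know: its
-- relation is the union of those of τ(a), so E_{σ(G)} coincides with E_G since the τ-images
-- of σ(G) cover G. From a structure over A', let agent i behave as σ(i), and as a fixed
-- relation R when σ(i) is undefined; E_G then coincides with E_{σ(G)} as long as R is
-- contained in the union of the relations of σ(G). Taking R empty, or the identity when
-- σ(G) is nonempty and the structure is reflexive, gives the two cases of the theorem.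
-- Once E_G and E_{σ(G)} agree, so do their iterates, hence C_G and C_{σ(G)}, and truth of
-- φ and φ^σ follows by induction on φ.
module Submission where

open import Defs
open import Level using (0ℓ)
open import Data.Maybe using (Maybe; just; nothing)
open import Data.Nat using (zero; suc)
open import Data.Product using (Σ; _×_; _,_; proj₁; proj₂)
open import Data.Sum using (_⊎_; inj₁; inj₂)
open import Data.Empty using (⊥)
open import Function using (id)
open import Function.Bundles using (_⇔_; mk⇔; Equivalence)
open import Relation.Binary.Core using (Rel)
open import Relation.Unary using (Pred; _≐_)
open import Relation.Binary.PropositionalEquality using (_≡_; refl)

private
  variable
    Φ A A' : Set

relabel : (M : Kripke Φ A) → (A' → Rel (Kripke.S M) 0ℓ) → Kripke Φ A'
relabel M 𝒦' = record { S = Kripke.S M ; π = Kripke.π M ; 𝒦 = 𝒦' }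

iter-preserves : {X Y : Set₁} (_∼_ : X → Y → Set) {f : X → X} {g : Y → Y} →
  (∀ {x y} → x ∼ y → f x ∼ g y) → ∀ n {x y} → x ∼ y → iter n f x ∼ iter n g y
iter-preserves _∼_ f∼g zero    x∼y = x∼y
iter-preserves _∼_ f∼g (suc n) x∼y = f∼g (iter-preserves _∼_ f∼g n x∼y)

module Transfer (σ : A → Maybe A') (M : Kripke Φ A) (𝒦' : A' → Rel (Kripke.S M) 0ℓ) where

  open Kripke M using (S)

  M' : Kripke Φ A'
  M' = relabel M 𝒦'

  ETransfers : Group A → Set₁
  ETransfers G = ∀ {P Q : Pred S 0ℓ} → P ≐ Q → semE M G P ≐ semE M' (image σ G) Q

  module _ {Good : Group A → Set} (transfer : ∀ {G} → Good G → ETransfers G) where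

    sat-^ : ∀ φ → AllGroups Good φ → (λ s → sat M s φ) ≐ (λ s → sat M' s (φ ^ σ))
    sat-^ (atom p) _ = id , id
    sat-^ (φ ∧′ ψ) (good-φ , good-ψ) =
      (λ (p , q) → proj₁ φ≐ p , proj₁ ψ≐ q) , (λ (p , q) → proj₂ φ≐ p , proj₂ ψ≐ q)
      where
        φ≐ = sat-^ φ good-φ
        ψ≐ = sat-^ ψ good-ψ
    sat-^ (¬′ φ) good-φ = (λ ¬p q → ¬p (proj₂ φ≐ q)) , (λ ¬q p → ¬q (proj₁ φ≐ p))
      where φ≐ = sat-^ φ good-φ
    sat-^ (E G φ) (good-G , good-φ) = transfer good-G (sat-^ φ good-φ)
    sat-^ (C G φ) (good-G , good-φ) =
      (λ c k → proj₁ (Eᵏ≐ (suc k)) (c k)) , (λ c k → proj₂ (Eᵏ≐ (suc k)) (c k))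
      where Eᵏ≐ = λ n → iter-preserves _≐_ (transfer good-G) n (sat-^ φ good-φ)

module _ (M : Kripke Φ A) (τ : A' → Group A) where

  open Kripke M

  unionRelations : A' → Rel S 0ℓ
  unionRelations a s t = Σ A λ i → τ a i × 𝒦 i s t

  union-reflexive : Reflexive M → (∀ a → Nonempty (τ a)) → Reflexive (relabel M unionRelations)
  union-reflexive refl-M τ≠∅ a s = let (i , τai) = τ≠∅ a in i , τai , refl-M i s

  semE-union : (σ : A → Maybe A') {G : Group A} →
    (∀ i → G i ⇔ Σ A' (λ a → image σ G a × τ a i)) →
    Transfer.ETransfers σ M unionRelations G
  semE-union σ G≡⋃ (P⊆Q , Q⊆P) =
    (λ e a a∈σG t (i , τai , k) → P⊆Q (e i (Equivalence.from (G≡⋃ i) (a , a∈σG , τai)) t k)) ,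
    (λ e i Gi t k → let (a , a∈σG , τai) = Equivalence.to (G≡⋃ i) Gi in
                    Q⊆P (e a a∈σG t (i , τai , k)))

module _ (σ : A → Maybe A') (M' : Kripke Φ A') (R : Rel (Kripke.S M') 0ℓ) where

  open Kripke M'

  pullbackRelations : A → Rel S 0ℓ
  pullbackRelations i s t = (Σ A' λ a → σ i ≡ just a × 𝒦 a s t) ⊎ (σ i ≡ nothing × R s t)

  pullback-reflexive : Reflexive M' → (∀ s → R s s) → Reflexive (relabel M' pullbackRelations)
  pullback-reflexive refl-M' refl-R i s with σ i
  ... | just a  = inj₁ (a , refl , refl-M' a s)
  ... | nothing = inj₂ (refl , refl-R s)

  semE-pullback : {G : Group A} →
    (∀ {s t} → R s t → Σ A' λ a → image σ G a × 𝒦 a s t) →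
    Transfer.ETransfers σ (relabel M' pullbackRelations) 𝒦 G
  semE-pullback R⊆⋃σG (P⊆Q , Q⊆P) =
    (λ e a (i , Gi , σi≡a) t k → P⊆Q (e i Gi t (inj₁ (a , σi≡a , k)))) ,
    (λ { e i Gi t (inj₁ (a , σi≡a , k)) → Q⊆P (e a (i , Gi , σi≡a) t k)
       ; e i Gi t (inj₂ (_ , r)) → let (a , a∈σG , k) = R⊆⋃σG r in Q⊆P (e a a∈σG t k) })

proposition4p1 : {Φ A A' : Set} (φ : Formula Φ A) (σ : A → Maybe A') →
    AllGroups (λ G → Nonempty (image σ G)) φ →
    (τ : A' → Group A) → (∀ a → Nonempty (τ a)) →
    AllGroups (λ G → ∀ i → G i ⇔ Σ A' (λ a → image σ G a × τ a i)) φ →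
    (Satisfiable φ ⇔ Satisfiable (φ ^ σ)) × (SatisfiableR φ ⇔ SatisfiableR (φ ^ σ))
proposition4p1 {Φ} {A} {A'} φ σ σG≠∅ τ τ≠∅ G≡⋃τσG =
  mk⇔ (λ (M , s , p) → _ , s , union M p)
      (λ (M' , s , p) → _ , s , pullback M' (λ _ _ → ⊥) (λ _ ()) p) ,
  mk⇔ (λ (M , refl-M , s , p) → _ , union-reflexive M τ refl-M τ≠∅ , s , union M p)
      (λ (M' , refl-M' , s , p) →
        _ , pullback-reflexive σ M' _≡_ refl-M' (λ _ → refl) , s ,
        pullback M' _≡_ (λ (a , a∈σG) → λ { {s} refl → a , a∈σG , refl-M' a s }) p)
  where
    union : (M : Kripke Φ A) → ∀ {s} → sat M s φ → sat (relabel M (unionRelations M τ)) s (φ ^ σ)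
    union M = proj₁ (Transfer.sat-^ σ M (unionRelations M τ) (semE-union M τ σ) φ G≡⋃τσG)

    pullback : (M' : Kripke Φ A') (R : Rel (Kripke.S M') 0ℓ) →
      (∀ {G} → Nonempty (image σ G) →
        ∀ {s t} → R s t → Σ A' λ a → image σ G a × Kripke.𝒦 M' a s t) →
      ∀ {s} → sat M' s (φ ^ σ) → sat (relabel M' (pullbackRelations σ M' R)) s φ
    pullback M' R R⊆⋃σG =
      proj₂ (Transfer.sat-^ σ (relabel M' (pullbackRelations σ M' R)) (Kripke.𝒦 M')
               (λ σG≠∅′ → semE-pullback σ M' R (R⊆⋃σG σG≠∅′)) φ σG≠∅)
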